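{- Let $n$ be a positive integer and let $\mathfrak{p}_n(d)=|\{S\in\mathsf{APS}_n : |S|\le d\}|$. Then for all integers $d$ with $0\le d\le \lfloor (n-1)/2\rfloor$, $$\mathfrak{p}_n(d)=\binom{n-1}{d}.$$
   Context: $\mathfrak{S}_n$ is the symmetric group on $[n]=\{1,\dots,n\}$, with permutations written in one-line notation $w(1)\cdots w(n)$. A pinnacle of $w$ is a value $w(i)$ with $2\le i\le n-1$ and $w(i-1)<w(i)>w(i+1)$; the pinnacle set of $w$ is the set of its pinnacles. $\mathsf{APS}_n$ is the set of all subsets of $[n]$ that are the pinnacle set of some $w\in\mathfrak{S}_n$. -}

module Defs where

open import Data.Nat using (ℕ; suc; _≤_)
open import Data.Fin using (Fin; toℕ; _<_)
open import Data.Fin.Subset using (Subset; _∈_; ∣_∣)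
open import Data.Fin.Permutation using (Permutation′; _⟨$⟩ʳ_)
open import Data.Product using (Σ; ∃; _×_)
open import Data.List using (List; length)
import Data.List.Membership.Propositional as LM
open import Data.List.Relation.Unary.Unique.Propositional using (Unique)
open import Function.Bundles using (_⇔_)
open import Relation.Binary.PropositionalEquality using (_≡_)

-- Convention: [n] is modelled by Fin n (value k ∈ Fin n stands for k+1),
-- positions are likewise Fin n; a permutation w ∈ 𝔖_n is a bijection Fin n ↔ Fin n,
-- with w(i) = w ⟨$⟩ʳ i.

IsPinnacle : {n : ℕ} → Permutation′ n → Fin n → Set
IsPinnacle {n} w v =
  Σ (Fin n) λ i → Σ (Fin n) λ j → Σ (Fin n) λ k →
    (toℕ j ≡ suc (toℕ i)) × (toℕ k ≡ suc (toℕ j)) ×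
    ((w ⟨$⟩ʳ i) < (w ⟨$⟩ʳ j)) × ((w ⟨$⟩ʳ k) < (w ⟨$⟩ʳ j)) × ((w ⟨$⟩ʳ j) ≡ v)

IsPinnacleSet : {n : ℕ} → Permutation′ n → Subset n → Set
IsPinnacleSet {n} w S = (v : Fin n) → (v ∈ S) ⇔ IsPinnacle w v

InAPS : (n : ℕ) → Subset n → Set
InAPS n S = ∃ λ (w : Permutation′ n) → IsPinnacleSet w S

SmallAPS : (n d : ℕ) → Subset n → Set
SmallAPS n d S = InAPS n S × (∣ S ∣ ≤ d)

HasCard : (n : ℕ) → (Subset n → Set) → ℕ → Set
HasCard n P m =
  Σ (List (Subset n)) λ L →
    Unique L × ((S : Subset n) → (S LM.∈ L) ⇔ P S) × (length L ≡ m)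

-- Shift values down by one, so S ⊆ {0, …, n − 1}. Then S is a pinnacle set iff every v ∈ S has at
-- least 2 + 2 · #{u ∈ S : u < v} values below it. Necessity: deleting the largest value of a
-- permutation keeps all smaller pinnacles, and a word of length n has at most (n − 1)/2 pinnacles.
-- Sufficiency: build the word value by value, appending each non-pinnacle at the end and inserting
-- each new pinnacle into a pinnacle-free tail. The admissible sets with at most d elements are
-- then counted by a ballot argument, and for 2d ≤ n − 1 the count telescopes to (n − 1) C d.

module Submission where

open import Defs
open import Data.Nat using (ℕ; zero; suc; _+_; _*_; _∸_; _/_; _≤_; _<_; _<?_; pred; z≤n; s≤s)
open import Data.Nat.Properties
open import Data.Nat.Combinatorics using (_C_; nCk+nC[k+1]≡[n+1]C[k+1])
open import Data.Nat.DivMod using (m/n*n≤m)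
open import Data.Nat.Solver using (module +-*-Solver)
open import Data.Bool using (Bool; true; false)
open import Data.Fin using (Fin; zero; suc; toℕ; fromℕ<; inject₁; fromℕ)
open import Data.Fin.Properties using (toℕ<n; toℕ-fromℕ<; toℕ-injective; toℕ-inject₁; toℕ-fromℕ)
open import Data.Fin.Relation.Unary.Top using (view; ‵fromℕ; ‵inject₁)
open import Data.Fin.Subset using (Subset; ∣_∣)
open import Data.Fin.Permutation using (Permutation′; _⟨$⟩ʳ_; _⟨$⟩ˡ_; permutation; inverseʳ; inverseˡ)
open import Data.Vec using (Vec; []; _∷_; _∷ʳ_; lookup; initLast)
open import Data.Vec.Properties using ([]=↔lookup; lookup⇒[]=)
import Data.List as List
open import Data.List using (List; []; _∷_; _++_; [_]; map; length; tabulate; upTo)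
open import Data.List.Properties using (length-++; length-map; length-++-sucʳ; ++-identityʳ; ++-assoc; length-upTo; upTo-∷ʳ; tabulate-cong; tabulate-lookup)
open import Data.List.Membership.Propositional using (_∈_; _∉_)
open import Data.List.Membership.Propositional.Properties using (∈-map⁺; ∈-map⁻; ∈-++⁺ˡ; ∈-++⁺ʳ; ∈-++⁻; ∈-∃++; ∈-tabulate⁺; ∈-tabulate⁻; ∈-lookup; ∈-upTo⁺; ∈-upTo⁻)
open import Data.List.Membership.Propositional.Properties.WithK using (unique∧set⇒bag)
open import Data.List.Relation.Unary.Any using (here; there; index)
open import Data.List.Relation.Unary.Any.Properties using (lookup-index)
import Data.List.Relation.Unary.All as All
open import Data.List.Relation.Unary.AllPairs using ([]; _∷_)
open import Data.List.Relation.Unary.Unique.Propositional using (Unique)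
import Data.List.Relation.Unary.Unique.Propositional.Properties as Unique
open import Data.List.Relation.Binary.Disjoint.Propositional using (Disjoint)
open import Data.List.Relation.Binary.Permutation.Propositional using (_↭_; ↭-refl; ↭-sym; ↭-trans; ↭-prep; ↭-reflexive; ↭⇒↭ₛ; module PermutationReasoning)
open import Data.List.Relation.Binary.Permutation.Propositional.Properties using (∈-resp-↭; shift; drop-mid; ∷↭∷ʳ; ++⁺ʳ; ↭-length)
open import Data.List.Relation.Binary.BagAndSetEquality using (∼bag⇒↭)
open import Data.Product using (Σ; _×_; _,_; map₁; uncurry)
open import Data.Sum using (inj₁; inj₂)
open import Data.Empty using (⊥-elim)
open import Relation.Nullary using (¬_; Dec; yes; no)
open import Function.Base using (_∘_)
open import Function.Bundles using (_⇔_; mk⇔; Equivalence)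
open import Function.Properties.Equivalence using () renaming (trans to ⇔-trans; sym to ⇔-sym)
open import Function.Properties.Inverse using (↔⇒⇔)
open import Relation.Binary.PropositionalEquality hiding ([_])
open import Data.List.Relation.Binary.Permutation.Setoid.Properties (setoid ℕ) using (Unique-resp-↭)
open +-*-Solver

-- Admissible subsets and their enumeration

-- Admissible h S reads the values 0, 1, … in increasing order starting with h credits: a value
-- outside S earns a credit, a value in S needs two and spends one.
data Admissible : {m : ℕ} → ℕ → Vec Bool m → Set where
  []   : ∀ {h} → Admissible h []
  skip : ∀ {m h} {S : Vec Bool m} → Admissible (suc h) S → Admissible h (false ∷ S)
  peak : ∀ {m h} {S : Vec Bool m} → Admissible (suc h) S → Admissible (suc (suc h)) (true ∷ S)

∣∷ʳfalse∣ : ∀ {n} (S : Vec Bool n) → ∣ S ∷ʳ false ∣ ≡ ∣ S ∣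
∣∷ʳfalse∣ []          = refl
∣∷ʳfalse∣ (true ∷ S)  = cong suc (∣∷ʳfalse∣ S)
∣∷ʳfalse∣ (false ∷ S) = ∣∷ʳfalse∣ S

∣∷ʳtrue∣ : ∀ {n} (S : Vec Bool n) → ∣ S ∷ʳ true ∣ ≡ suc ∣ S ∣
∣∷ʳtrue∣ []          = refl
∣∷ʳtrue∣ (true ∷ S)  = cong suc (∣∷ʳtrue∣ S)
∣∷ʳtrue∣ (false ∷ S) = ∣∷ʳtrue∣ S

Admissible-∷ʳ⁻ : ∀ {m h b} {S : Vec Bool m} → Admissible h (S ∷ʳ b) → Admissible h S
Admissible-∷ʳ⁻ {S = []}    _        = []
Admissible-∷ʳ⁻ {S = _ ∷ _} (skip a) = skip (Admissible-∷ʳ⁻ a)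
Admissible-∷ʳ⁻ {S = _ ∷ _} (peak a) = peak (Admissible-∷ʳ⁻ a)

Admissible-∷ʳfalse : ∀ {m h} {S : Vec Bool m} → Admissible h S → Admissible h (S ∷ʳ false)
Admissible-∷ʳfalse []       = skip []
Admissible-∷ʳfalse (skip a) = skip (Admissible-∷ʳfalse a)
Admissible-∷ʳfalse (peak a) = peak (Admissible-∷ʳfalse a)

Admissible-∷ʳtrue : ∀ {m h} {S : Vec Bool m} →
  Admissible h S → 2 * suc ∣ S ∣ ≤ h + m → Admissible h (S ∷ʳ true)
Admissible-∷ʳtrue {h = suc (suc h)} [] _ = peak []
Admissible-∷ʳtrue {h = suc zero} [] (s≤s ())
Admissible-∷ʳtrue {m = suc m} {h} (skip {S = S} a) bound =
  skip (Admissible-∷ʳtrue a (subst (2 * suc ∣ S ∣ ≤_) (+-suc h m) bound))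
Admissible-∷ʳtrue {m = suc m} (peak {h = h} {S = S} a) bound =
  peak (Admissible-∷ʳtrue a (≤-pred (≤-pred (subst₂ _≤_ (*-suc 2 (suc ∣ S ∣)) (cong (2 +_) (+-suc h m)) bound))))

Admissible-∷ʳtrue⁻ : ∀ {m h} {S : Vec Bool m} → Admissible h (S ∷ʳ true) → 2 * suc ∣ S ∣ ≤ h + m
Admissible-∷ʳtrue⁻ {S = []} (peak _) = s≤s (s≤s z≤n)
Admissible-∷ʳtrue⁻ {m = suc m} {h} {false ∷ S} (skip a) =
  subst (2 * suc ∣ S ∣ ≤_) (sym (+-suc h m)) (Admissible-∷ʳtrue⁻ a)
Admissible-∷ʳtrue⁻ {m = suc m} {S = true ∷ S} (peak {h = h} a) =
  subst₂ _≤_ (sym (*-suc 2 (suc ∣ S ∣))) (cong (2 +_) (sym (+-suc h m))) (s≤s (s≤s (Admissible-∷ʳtrue⁻ a)))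

admissibles : (m h d : ℕ) → List (Vec Bool m)
peaked : (m h d : ℕ) → List (Vec Bool (suc m))
admissibles zero    h d = [ [] ]
admissibles (suc m) h d = map (false ∷_) (admissibles m (suc h) d) ++ peaked m h d
peaked m (suc (suc h)) (suc d) = map (true ∷_) (admissibles m (suc h) d)
peaked m _             _       = []

∈-admissibles⁻ : ∀ {m h d} {S : Vec Bool m} → S ∈ admissibles m h d → Admissible h S × ∣ S ∣ ≤ d
∈-admissibles⁻ {zero} {S = []} _ = [] , z≤n
∈-admissibles⁻ {suc m} {h} {d} p with ∈-++⁻ (map (false ∷_) (admissibles m (suc h) d)) p
... | inj₁ q with _ , q′ , refl ← ∈-map⁻ _ q
  = let a , c = ∈-admissibles⁻ q′ in skip a , c
∈-admissibles⁻ {suc m} {suc (suc h)} {suc d} p | inj₂ q with _ , q′ , refl ← ∈-map⁻ _ q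
  = let a , c = ∈-admissibles⁻ q′ in peak a , s≤s c

∈-admissibles⁺ : ∀ {m h d} {S : Vec Bool m} → Admissible h S → ∣ S ∣ ≤ d → S ∈ admissibles m h d
∈-admissibles⁺ [] _ = here refl
∈-admissibles⁺ (skip a) c = ∈-++⁺ˡ (∈-map⁺ (false ∷_) (∈-admissibles⁺ a c))
∈-admissibles⁺ {suc m} {suc (suc h)} {suc d} (peak a) (s≤s c) =
  ∈-++⁺ʳ (map (false ∷_) (admissibles m (suc (suc (suc h))) (suc d))) (∈-map⁺ (true ∷_) (∈-admissibles⁺ a c))

admissibles-unique : ∀ m h d → Unique (admissibles m h d)
admissibles-unique zero    h d = All.[] ∷ []
admissibles-unique (suc m) h d =
  Unique.++⁺ (Unique.map⁺ ∷-injectiveʳ (admissibles-unique m (suc h) d)) (peaked-unique h d) (disjoint h d)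
  where
    ∷-injectiveʳ : ∀ {b} {S T : Vec Bool m} → b ∷ S ≡ b ∷ T → S ≡ T
    ∷-injectiveʳ refl = refl
    peaked-unique : ∀ h d → Unique (peaked m h d)
    peaked-unique (suc (suc h)) (suc d) = Unique.map⁺ ∷-injectiveʳ (admissibles-unique m (suc h) d)
    peaked-unique zero          _       = []
    peaked-unique (suc zero)    _       = []
    peaked-unique (suc (suc h)) zero    = []
    disjoint : ∀ h d → Disjoint (map (false ∷_) (admissibles m (suc h) d)) (peaked m h d)
    disjoint (suc (suc h)) (suc d) (p , q) with _ , _ , refl ← ∈-map⁻ _ p with _ , _ , () ← ∈-map⁻ _ q

+-rearrange : ∀ a b c d → (a + b) + (c + d) ≡ (a + d) + (b + c)
+-rearrange = solve 4 (λ a b c d → (a :+ b) :+ (c :+ d) := (a :+ d) :+ (b :+ c)) refl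

binomialSum : ℕ → ℕ → ℕ
binomialSum m zero    = 0
binomialSum m (suc j) = binomialSum m j + m C j

binomialSum-0 : ∀ j → binomialSum 0 (suc j) ≡ 1
binomialSum-0 zero    = refl
binomialSum-0 (suc j) = trans (+-identityʳ (binomialSum 0 (suc j))) (binomialSum-0 j)

binomialSum-pascal : ∀ m j → binomialSum (suc m) j ≡ binomialSum m j + binomialSum m (pred j)
binomialSum-pascal m zero          = refl
binomialSum-pascal m (suc zero)    = refl
binomialSum-pascal m (suc (suc j)) = begin
  binomialSum (suc m) (suc j) + suc m C suc j
    ≡⟨ cong₂ _+_ (binomialSum-pascal m (suc j)) (sym (nCk+nC[k+1]≡[n+1]C[k+1] m j)) ⟩
  (binomialSum m (suc j) + binomialSum m j) + (m C j + m C suc j)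
    ≡⟨ +-rearrange (binomialSum m (suc j)) (binomialSum m j) (m C j) (m C suc j) ⟩
  (binomialSum m (suc j) + m C suc j) + (binomialSum m j + m C j) ∎
  where open ≡-Reasoning

length-admissibles-suc : ∀ m h d →
  length (admissibles (suc m) h d) ≡ length (admissibles m (suc h) d) + length (peaked m h d)
length-admissibles-suc m h d = trans (length-++ (map (false ∷_) (admissibles m (suc h) d)))
                                     (cong (_+ length (peaked m h d)) (length-map (false ∷_) (admissibles m (suc h) d)))

-- That is, length (admissibles m (1 + a) d) = Σ_{d ∸ a ≤ i ≤ d} m C i, a telescoped sum of ballot numbers.
length-admissibles : ∀ m a d → 2 * d ≤ m + a →
  length (admissibles m (suc a) d) + binomialSum m (d ∸ a) ≡ binomialSum m (suc d)
length-admissibles zero a d 2d≤a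
  rewrite m≤n⇒m∸n≡0 (≤-trans (m≤m+n d (d + 0)) 2d≤a) = sym (binomialSum-0 d)
length-admissibles (suc m) zero d 2d≤m = begin
  length (admissibles (suc m) 1 d) + binomialSum (suc m) d
    ≡⟨ cong₂ _+_ (trans (length-admissibles-suc m 1 d) (+-identityʳ _)) (binomialSum-pascal m d) ⟩
  L + (binomialSum m d + binomialSum m (pred d))
    ≡⟨ trans (cong (L +_) (+-comm (binomialSum m d) _)) (sym (+-assoc L _ (binomialSum m d))) ⟩
  (L + binomialSum m (d ∸ 1)) + binomialSum m d
    ≡⟨ cong (_+ binomialSum m d) (length-admissibles m 1 d 2d≤m+1) ⟩
  binomialSum m (suc d) + binomialSum m d
    ≡⟨ sym (binomialSum-pascal m (suc d)) ⟩
  binomialSum (suc m) (suc d) ∎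
  where
    open ≡-Reasoning
    L = length (admissibles m 2 d)
    2d≤m+1 : 2 * d ≤ m + 1
    2d≤m+1 = subst (2 * d ≤_) (trans (+-comm (suc m) 0) (+-comm 1 m)) 2d≤m
length-admissibles (suc m) (suc a) zero _ = begin
  length (admissibles (suc m) (2 + a) 0) + 0
    ≡⟨ trans (+-identityʳ _) (length-admissibles-suc m (2 + a) 0) ⟩
  length (admissibles m (3 + a) 0) + 0
    ≡⟨ length-admissibles m (2 + a) 0 z≤n ⟩
  binomialSum (suc m) 1 ∎
  where open ≡-Reasoning
length-admissibles (suc m) (suc a) (suc d) bound = begin
  length (admissibles (suc m) (2 + a) (suc d)) + binomialSum (suc m) e
    ≡⟨ cong₂ _+_ (trans (length-admissibles-suc m (2 + a) (suc d))
                        (cong (L₁ +_) (length-map (true ∷_) (admissibles m (suc a) d))))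
                 (binomialSum-pascal m e) ⟩
  (L₁ + L₂) + (binomialSum m e + binomialSum m (pred e))
    ≡⟨ +-rearrange L₁ L₂ (binomialSum m e) (binomialSum m (pred e)) ⟩
  (L₁ + binomialSum m (pred e)) + (L₂ + binomialSum m e)
    ≡⟨ cong₂ _+_ (trans (cong (λ j → L₁ + binomialSum m j) (pred[m∸n]≡m∸[1+n] d a))
                        (length-admissibles m (2 + a) (suc d) bound₁))
                 (length-admissibles m a d bound₂) ⟩
  binomialSum m (2 + d) + binomialSum m (suc d)
    ≡⟨ sym (binomialSum-pascal m (2 + d)) ⟩
  binomialSum (suc m) (2 + d) ∎
  where
    open ≡-Reasoning
    L₁ = length (admissibles m (3 + a) (suc d))
    L₂ = length (admissibles m (suc a) d)
    e = d ∸ a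
    bound₁ : 2 * suc d ≤ m + (2 + a)
    bound₁ = subst (2 * suc d ≤_) (sym (+-suc m (suc a))) bound
    bound₂ : 2 * d ≤ m + a
    bound₂ = ≤-pred (≤-pred (subst₂ _≤_ (*-suc 2 d) (cong suc (+-suc m a)) bound))

length-admissibles-0 : ∀ m d → 2 * d ≤ m → length (admissibles (suc m) 0 d) ≡ m C d
length-admissibles-0 m d 2d≤m = +-cancelʳ-≡ _ _ _ (begin
  length (admissibles (suc m) 0 d) + binomialSum m d
    ≡⟨ cong (_+ binomialSum m d) (trans (length-admissibles-suc m 0 d) (+-identityʳ _)) ⟩
  length (admissibles m 1 d) + binomialSum m (d ∸ 0)
    ≡⟨ length-admissibles m 0 d (subst (2 * d ≤_) (sym (+-identityʳ m)) 2d≤m) ⟩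
  binomialSum m d + m C d
    ≡⟨ +-comm (binomialSum m d) (m C d) ⟩
  m C d + binomialSum m d ∎)
  where open ≡-Reasoning

-- Pinnacles of words

data Pinnacle (b : ℕ) : List ℕ → Set where
  here  : ∀ {a c ws} → a < b → c < b → Pinnacle b (a ∷ b ∷ c ∷ ws)
  there : ∀ {x ws} → Pinnacle b ws → Pinnacle b (x ∷ ws)

Pinnacle⇒∈ : ∀ {v ws} → Pinnacle v ws → v ∈ ws
Pinnacle⇒∈ (here _ _) = there (here refl)
Pinnacle⇒∈ (there p)  = there (Pinnacle⇒∈ p)

Pinnacle-∷⇒∈ : ∀ {v x ws} → Pinnacle v (x ∷ ws) → v ∈ ws
Pinnacle-∷⇒∈ (here _ _) = here refl
Pinnacle-∷⇒∈ (there p)  = Pinnacle⇒∈ p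

Pinnacle-++⁺ˡ : ∀ {v} xs ys → Pinnacle v xs → Pinnacle v (xs ++ ys)
Pinnacle-++⁺ˡ _        ys (here a<v c<v) = here a<v c<v
Pinnacle-++⁺ˡ (_ ∷ xs) ys (there p)      = there (Pinnacle-++⁺ˡ xs ys p)

Pinnacle-∷ʳ⇒∈ : ∀ {v x} xs → Pinnacle v (xs ++ [ x ]) → v ∈ xs
Pinnacle-∷ʳ⇒∈ (a ∷ b ∷ []) (here _ _)     = there (here refl)
Pinnacle-∷ʳ⇒∈ (a ∷ b ∷ c ∷ xs) (here _ _) = there (here refl)
Pinnacle-∷ʳ⇒∈ (a ∷ xs) (there p)          = there (Pinnacle-∷ʳ⇒∈ xs p)
Pinnacle-∷ʳ⇒∈ []       (there ())

Pinnacle-delete : ∀ {v M} xs ys → v < M → Pinnacle v (xs ++ M ∷ ys) → Pinnacle v (xs ++ ys)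
Pinnacle-delete []            ys v<M (here M<v _)       = ⊥-elim (<-asym v<M M<v)
Pinnacle-delete []            ys v<M (there p)          = p
Pinnacle-delete (a ∷ [])      ys v<M (here _ _)         = ⊥-elim (<-irrefl refl v<M)
Pinnacle-delete (a ∷ [])      ys v<M (there p)          = there (Pinnacle-delete [] ys v<M p)
Pinnacle-delete (a ∷ b ∷ [])  ys v<M (here _ M<v)       = ⊥-elim (<-asym v<M M<v)
Pinnacle-delete (a ∷ b ∷ c ∷ xs) ys v<M (here a<v c<v) = here a<v c<v
Pinnacle-delete (a ∷ b ∷ xs)  ys v<M (there p)          = there (Pinnacle-delete (b ∷ xs) ys v<M p)

Pinnacle-insert : ∀ {v b M} xs ys → v ≢ b → v ∉ ys → Pinnacle v (xs ++ b ∷ ys) → Pinnacle v (xs ++ b ∷ M ∷ ys)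
Pinnacle-insert []               ys v≢b v∉ys p              = ⊥-elim (v∉ys (Pinnacle-∷⇒∈ p))
Pinnacle-insert (a ∷ [])         ys v≢b v∉ys (here _ _)     = ⊥-elim (v≢b refl)
Pinnacle-insert (a ∷ [])         ys v≢b v∉ys (there p)      = ⊥-elim (v∉ys (Pinnacle-∷⇒∈ p))
Pinnacle-insert (a ∷ c ∷ [])     ys v≢b v∉ys (here a<v b<v) = here a<v b<v
Pinnacle-insert (a ∷ c ∷ d ∷ xs) ys v≢b v∉ys (here a<v d<v) = here a<v d<v
Pinnacle-insert (a ∷ c ∷ xs)     ys v≢b v∉ys (there p)      = there (Pinnacle-insert (c ∷ xs) ys v≢b v∉ys p)

Pinnacle-inserted : ∀ {M b c} xs ys → b < M → c < M → Pinnacle M (xs ++ b ∷ M ∷ c ∷ ys)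
Pinnacle-inserted []       ys b<M c<M = here b<M c<M
Pinnacle-inserted (a ∷ xs) ys b<M c<M = there (Pinnacle-inserted xs ys b<M c<M)

Pinnacle-∷ʳ⇔ : ∀ {v M} ws → v < M → Pinnacle v ws ⇔ Pinnacle v (ws ++ [ M ])
Pinnacle-∷ʳ⇔ {v} {M} ws v<M =
  mk⇔ (Pinnacle-++⁺ˡ ws [ M ]) (λ p → subst (Pinnacle v) (++-identityʳ ws) (Pinnacle-delete ws [] v<M p))

Pinnacle-insert⇔ : ∀ {v b M} xs ys → v < M → (∀ {x} → x ∈ b ∷ ys → ¬ Pinnacle x (xs ++ b ∷ ys)) →
  Pinnacle v (xs ++ b ∷ ys) ⇔ Pinnacle v (xs ++ b ∷ M ∷ ys)
Pinnacle-insert⇔ {v} {b} {M} xs ys v<M free = mk⇔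
  (λ p → Pinnacle-insert xs ys (λ { refl → free (here refl) p }) (λ v∈ys → free (there v∈ys) p) p)
  (λ p → subst (Pinnacle v) (++-assoc xs [ b ] ys)
           (Pinnacle-delete (xs ++ [ b ]) ys v<M (subst (Pinnacle v) (sym (++-assoc xs [ b ] (M ∷ ys))) p)))

consIfPeak : ∀ {a b c} → Dec (a < b) → Dec (c < b) → List ℕ → List ℕ
consIfPeak {b = b} (yes _) (yes _) ps = b ∷ ps
consIfPeak         _       _       ps = ps

pinnacles : List ℕ → List ℕ
pinnacles (a ∷ ws@(b ∷ c ∷ _)) = consIfPeak (a <? b) (c <? b) (pinnacles ws)
pinnacles _                    = []

Pinnacle⇒∈pinnacles : ∀ {v} ws → Pinnacle v ws → v ∈ pinnacles ws
Pinnacle⇒∈pinnacles (a ∷ b ∷ c ∷ ws) p with a <? b | c <? b | p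
... | yes _  | yes _  | here _ _   = here refl
... | yes _  | yes _  | there p′   = there (Pinnacle⇒∈pinnacles _ p′)
... | no a≮b | _      | here a<b _ = ⊥-elim (a≮b a<b)
... | no _   | _      | there p′   = Pinnacle⇒∈pinnacles _ p′
... | yes _  | no c≮b | here _ c<b = ⊥-elim (c≮b c<b)
... | yes _  | no _   | there p′   = Pinnacle⇒∈pinnacles _ p′
Pinnacle⇒∈pinnacles (a ∷ b ∷ []) (there (there ()))
Pinnacle⇒∈pinnacles (a ∷ []) (there ())

pinnacles-descent : ∀ b c ws → c < b → pinnacles (b ∷ c ∷ ws) ≡ pinnacles (c ∷ ws)
pinnacles-descent b c []       _   = refl
pinnacles-descent b c (d ∷ ws) c<b with b <? c
... | yes b<c = ⊥-elim (<-asym b<c c<b)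
... | no _    = refl

length-pinnacles : ∀ ws → 2 * length (pinnacles ws) ≤ pred (length ws)
length-pinnacles []           = z≤n
length-pinnacles (_ ∷ [])     = z≤n
length-pinnacles (_ ∷ _ ∷ []) = z≤n
length-pinnacles (a ∷ b ∷ c ∷ ws) = step (a <? b) (c <? b) (length-pinnacles (c ∷ ws)) (length-pinnacles (b ∷ c ∷ ws))
  where
    step : (a<?b : Dec (a < b)) (c<?b : Dec (c < b)) →
           2 * length (pinnacles (c ∷ ws)) ≤ length ws → 2 * length (pinnacles (b ∷ c ∷ ws)) ≤ suc (length ws) →
           2 * length (consIfPeak a<?b c<?b (pinnacles (b ∷ c ∷ ws))) ≤ 2 + length ws
    step (yes _) (yes c<b) ih _ rewrite pinnacles-descent b c ws c<b =
      subst (_≤ 2 + length ws) (sym (*-suc 2 (length (pinnacles (c ∷ ws))))) (s≤s (s≤s ih))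
    step (yes _) (no _) _ ih = m≤n⇒m≤1+n ih
    step (no _)  _      _ ih = m≤n⇒m≤1+n ih

∣S∣≤length : ∀ {n} k (S : Vec Bool n) (P : List ℕ) →
  (∀ v → lookup S v ≡ true → k + toℕ v ∈ P) → ∣ S ∣ ≤ length P
∣S∣≤length k []          P S⊆P = z≤n
∣S∣≤length k (false ∷ S) P S⊆P =
  ∣S∣≤length (suc k) S P (λ v e → subst (_∈ P) (+-suc k (toℕ v)) (S⊆P (suc v) e))
∣S∣≤length k (true ∷ S)  P S⊆P with xs , ys , refl ← ∈-∃++ (subst (_∈ P) (+-identityʳ k) (S⊆P zero refl)) =
  subst (∣ S ∣ <_) (sym (length-++-sucʳ xs k ys)) (s≤s (∣S∣≤length (suc k) S (xs ++ ys) S⊆P′))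
  where
    S⊆P′ : ∀ v → lookup S v ≡ true → suc k + toℕ v ∈ xs ++ ys
    S⊆P′ v e with ∈-++⁻ xs (subst (_∈ xs ++ k ∷ ys) (+-suc k (toℕ v)) (S⊆P (suc v) e))
    ... | inj₁ q = ∈-++⁺ˡ q
    ... | inj₂ (here k+1+v≡k) = ⊥-elim (m+1+n≢m k (trans (+-suc k (toℕ v)) k+1+v≡k))
    ... | inj₂ (there q) = ∈-++⁺ʳ xs q

-- Arrangements of 0, …, n − 1 and permutations

∈-↭upTo⁻ : ∀ {n v ws} → ws ↭ upTo n → v ∈ ws → v < n
∈-↭upTo⁻ p v∈ws = ∈-upTo⁻ (∈-resp-↭ p v∈ws)

∈-↭upTo⁺ : ∀ {n v ws} → ws ↭ upTo n → v < n → v ∈ ws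
∈-↭upTo⁺ p v<n = ∈-resp-↭ (↭-sym p) (∈-upTo⁺ v<n)

length-↭upTo : ∀ {n ws} → ws ↭ upTo n → length ws ≡ n
length-↭upTo {n} p = trans (↭-length p) (length-upTo n)

↭upTo-insert : ∀ {n} xs ys → xs ++ ys ↭ upTo n → xs ++ n ∷ ys ↭ upTo (suc n)
↭upTo-insert {n} xs ys p = begin
  xs ++ [ n ] ++ ys ↭⟨ shift n xs ys ⟩
  n ∷ xs ++ ys      ↭⟨ ↭-prep n p ⟩
  n ∷ upTo n        ↭⟨ ∷↭∷ʳ n (upTo n) ⟩
  upTo n ++ [ n ]   ≡⟨ upTo-∷ʳ n ⟩
  upTo (suc n)      ∎
  where open PermutationReasoning

↭upTo-∷ʳ : ∀ {n ws} → ws ↭ upTo n → ws ++ [ n ] ↭ upTo (suc n)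
↭upTo-∷ʳ {n} p = ↭-trans (++⁺ʳ [ n ] p) (↭-reflexive (upTo-∷ʳ n))

↭upTo-delete : ∀ {n} xs ys → xs ++ n ∷ ys ↭ upTo (suc n) → xs ++ ys ↭ upTo n
↭upTo-delete {n} xs ys p = ↭-trans (drop-mid xs (upTo n) (↭-trans p (↭-reflexive (sym (upTo-∷ʳ n)))))
                                   (↭-reflexive (++-identityʳ (upTo n)))

wordOf : ∀ {n} → Permutation′ n → List ℕ
wordOf w = tabulate (λ i → toℕ (w ⟨$⟩ʳ i))

wordOf-↭upTo : ∀ {n} (w : Permutation′ n) → wordOf w ↭ upTo n
wordOf-↭upTo {n} w = ∼bag⇒↭ (unique∧set⇒bag (Unique.tabulate⁺ injective) (Unique.upTo⁺ n) (mk⇔ to from))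
  where
    injective : ∀ {i j} → toℕ (w ⟨$⟩ʳ i) ≡ toℕ (w ⟨$⟩ʳ j) → i ≡ j
    injective {i} {j} e = begin
      i                   ≡⟨ inverseˡ w ⟨
      w ⟨$⟩ˡ (w ⟨$⟩ʳ i)   ≡⟨ cong (w ⟨$⟩ˡ_) (toℕ-injective e) ⟩
      w ⟨$⟩ˡ (w ⟨$⟩ʳ j)   ≡⟨ inverseˡ w ⟩
      j                   ∎
      where open ≡-Reasoning
    to : ∀ {v} → v ∈ wordOf w → v ∈ upTo n
    to v∈ with _ , refl ← ∈-tabulate⁻ v∈ = ∈-upTo⁺ (toℕ<n _)
    from : ∀ {v} → v ∈ upTo n → v ∈ wordOf w
    from v∈ = subst (_∈ wordOf w) (trans (cong toℕ (inverseʳ w)) (toℕ-fromℕ< (∈-upTo⁻ v∈)))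
                    (∈-tabulate⁺ (w ⟨$⟩ˡ fromℕ< (∈-upTo⁻ v∈)))

lookup-injective : ∀ {xs : List ℕ} → Unique xs → ∀ {i j} → List.lookup xs i ≡ List.lookup xs j → i ≡ j
lookup-injective (_  ∷ _) {zero}  {zero}  _ = refl
lookup-injective (x∉ ∷ _) {zero}  {suc j} e = ⊥-elim (All.lookup x∉ (∈-lookup j) e)
lookup-injective (x∉ ∷ _) {suc i} {zero}  e = ⊥-elim (All.lookup x∉ (∈-lookup i) (sym e))
lookup-injective (_  ∷ u) {suc i} {suc j} e = cong suc (lookup-injective u e)

↭upTo⇒wordOf : ∀ {n ws} → ws ↭ upTo n → Σ (Permutation′ n) λ w → wordOf w ≡ ws
↭upTo⇒wordOf {ws = ws} p with refl ← length-↭upTo p =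
  w , trans (tabulate-cong (λ i → toℕ-fromℕ< _)) (tabulate-lookup ws)
  where
    unique : Unique ws
    unique = Unique-resp-↭ (↭⇒↭ₛ (↭-sym p)) (Unique.upTo⁺ (length ws))
    position : (v : Fin (length ws)) → toℕ v ∈ ws
    position v = ∈-↭upTo⁺ p (toℕ<n v)
    letter : Fin (length ws) → Fin (length ws)
    letter i = fromℕ< (∈-↭upTo⁻ p (∈-lookup i))
    w : Permutation′ (length ws)
    w = permutation letter (λ v → index (position v))
      (λ v → toℕ-injective (trans (toℕ-fromℕ< _) (sym (lookup-index (position v)))))
      (λ i → lookup-injective unique (trans (sym (lookup-index (position (letter i)))) (toℕ-fromℕ< _)))

SequencePinnacle : ∀ {n} → (Fin n → ℕ) → ℕ → Set
SequencePinnacle {n} f b = Σ (Fin n) λ i → Σ (Fin n) λ j → Σ (Fin n) λ k →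
  (toℕ j ≡ suc (toℕ i)) × (toℕ k ≡ suc (toℕ j)) × (f i < b) × (f k < b) × (f j ≡ b)

Pinnacle-tabulate⁻ : ∀ {n b} (f : Fin n → ℕ) → Pinnacle b (tabulate f) → SequencePinnacle f b
Pinnacle-tabulate⁻ {suc (suc (suc n))} f (here a<b c<b) = zero , suc zero , suc (suc zero) , refl , refl , a<b , c<b , refl
Pinnacle-tabulate⁻ {suc (suc (suc n))} f (there p)
  with i , j , k , j≡1+i , k≡1+j , rest ← Pinnacle-tabulate⁻ (λ i → f (suc i)) p =
  suc i , suc j , suc k , cong suc j≡1+i , cong suc k≡1+j , rest
Pinnacle-tabulate⁻ {suc (suc zero)} f (there (there ()))
Pinnacle-tabulate⁻ {suc zero}       f (there ())

Pinnacle-tabulate⁺ : ∀ {n b} (f : Fin n → ℕ) → SequencePinnacle f b → Pinnacle b (tabulate f)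
Pinnacle-tabulate⁺ f (zero , suc zero , suc (suc zero) , _ , _ , a<b , c<b , refl) = here a<b c<b
Pinnacle-tabulate⁺ f (zero , zero , _ , () , _)
Pinnacle-tabulate⁺ f (zero , suc (suc _) , _ , () , _)
Pinnacle-tabulate⁺ f (zero , suc zero , zero , _ , () , _)
Pinnacle-tabulate⁺ f (zero , suc zero , suc zero , _ , () , _)
Pinnacle-tabulate⁺ f (zero , suc zero , suc (suc (suc _)) , _ , () , _)
Pinnacle-tabulate⁺ f (suc i , zero , _ , () , _)
Pinnacle-tabulate⁺ f (suc i , suc j , zero , _ , () , _)
Pinnacle-tabulate⁺ f (suc i , suc j , suc k , j≡1+i , k≡1+j , rest) =
  there (Pinnacle-tabulate⁺ (λ i → f (suc i)) (i , j , k , suc-injective j≡1+i , suc-injective k≡1+j , rest))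

IsPinnacle⇔Pinnacle : ∀ {n} (w : Permutation′ n) v → IsPinnacle w v ⇔ Pinnacle (toℕ v) (wordOf w)
IsPinnacle⇔Pinnacle w v = mk⇔ to (from v)
  where
    to : IsPinnacle w v → Pinnacle (toℕ v) (wordOf w)
    to (i , j , k , j≡1+i , k≡1+j , i<j , k<j , refl) = Pinnacle-tabulate⁺ _ (i , j , k , j≡1+i , k≡1+j , i<j , k<j , refl)
    from : ∀ v → Pinnacle (toℕ v) (wordOf w) → IsPinnacle w v
    from v p with i , j , k , j≡1+i , k≡1+j , i<v , k<v , j≡v ← Pinnacle-tabulate⁻ _ p
             with refl ← toℕ-injective j≡v = i , j , k , j≡1+i , k≡1+j , i<v , k<v , refl

-- Pinnacle sets are the admissible subsets

lookup-∷ʳ-inject₁ : ∀ {n} (S : Vec Bool n) b i → lookup (S ∷ʳ b) (inject₁ i) ≡ lookup S i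
lookup-∷ʳ-inject₁ (_ ∷ _) b zero    = refl
lookup-∷ʳ-inject₁ (_ ∷ S) b (suc i) = lookup-∷ʳ-inject₁ S b i

lookup-∷ʳ-fromℕ : ∀ {n} (S : Vec Bool n) b → lookup (S ∷ʳ b) (fromℕ n) ≡ b
lookup-∷ʳ-fromℕ []      b = refl
lookup-∷ʳ-fromℕ (_ ∷ S) b = lookup-∷ʳ-fromℕ S b

_⊆Pinnacles_ : ∀ {n} → Subset n → List ℕ → Set
S ⊆Pinnacles ws = ∀ v → lookup S v ≡ true → Pinnacle (toℕ v) ws

PinnacleSet : ∀ {n} → Subset n → List ℕ → Set
PinnacleSet S ws = ∀ v → (lookup S v ≡ true) ⇔ Pinnacle (toℕ v) ws

⊆Pinnacles⇒Admissible : ∀ {n ws} (S : Subset n) → ws ↭ upTo n → S ⊆Pinnacles ws → Admissible 0 S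
⊆Pinnacles⇒Admissible {zero}  [] _ _ = []
⊆Pinnacles⇒Admissible {suc n} S p S⊆ with initLast S | ∈-∃++ (∈-↭upTo⁺ p (n<1+n n))
... | S′ , b , refl | xs , ys , refl = lastLetter b S⊆
  where
    init : ∀ b → (S′ ∷ʳ b) ⊆Pinnacles (xs ++ n ∷ ys) → Admissible 0 S′
    init b S⊆ = ⊆Pinnacles⇒Admissible S′ (↭upTo-delete xs ys p) λ v e →
      Pinnacle-delete xs ys (toℕ<n v)
        (subst (λ u → Pinnacle u (xs ++ n ∷ ys)) (toℕ-inject₁ v)
               (S⊆ (inject₁ v) (trans (lookup-∷ʳ-inject₁ S′ b v) e)))
    bound : (S′ ∷ʳ true) ⊆Pinnacles (xs ++ n ∷ ys) → 2 * suc ∣ S′ ∣ ≤ n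
    bound S⊆ = begin
      2 * suc ∣ S′ ∣                       ≡⟨ cong (2 *_) (∣∷ʳtrue∣ S′) ⟨
      2 * ∣ S′ ∷ʳ true ∣                   ≤⟨ *-monoʳ-≤ 2 (∣S∣≤length 0 (S′ ∷ʳ true) _ (λ v → Pinnacle⇒∈pinnacles _ ∘ S⊆ v)) ⟩
      2 * length (pinnacles (xs ++ n ∷ ys)) ≤⟨ length-pinnacles (xs ++ n ∷ ys) ⟩
      pred (length (xs ++ n ∷ ys))         ≡⟨ cong pred (length-↭upTo p) ⟩
      n                                    ∎
      where open ≤-Reasoning
    lastLetter : ∀ b → (S′ ∷ʳ b) ⊆Pinnacles (xs ++ n ∷ ys) → Admissible 0 (S′ ∷ʳ b)
    lastLetter false S⊆ = Admissible-∷ʳfalse (init false S⊆)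
    lastLetter true  S⊆ = Admissible-∷ʳtrue (init true S⊆) (bound S⊆)

PinnacleSet-∷ʳ : ∀ {n b ws ws′} {S : Subset n} → PinnacleSet S ws →
  (∀ {v} → v < n → Pinnacle v ws ⇔ Pinnacle v ws′) → (b ≡ true) ⇔ Pinnacle n ws′ →
  PinnacleSet (S ∷ʳ b) ws′
PinnacleSet-∷ʳ {n} {b} {S = S} old same top v with view v
... | ‵fromℕ rewrite lookup-∷ʳ-fromℕ S b | toℕ-fromℕ n = top
... | ‵inject₁ i rewrite lookup-∷ʳ-inject₁ S b i | toℕ-inject₁ i = ⇔-trans (old i) (same (toℕ<n i))

-- The pinnacles and their left neighbours fill the prefix, and the pinnacle-free suffix of
-- n ∸ 2 ∣ S ∣ letters is where the next pinnacle will be inserted.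
record CanonicalWord {n} (S : Subset n) : Set where
  constructor canonical
  field
    word          : List ℕ
    arrangement   : word ↭ upTo n
    pinnacleSet   : PinnacleSet S word
    prefix suffix : List ℕ
    split         : word ≡ prefix ++ suffix
    length-prefix : length prefix ≡ 2 * ∣ S ∣
    suffix-free   : ∀ {x} → x ∈ suffix → ¬ Pinnacle x word

extend-false : ∀ {n} {S : Subset n} → CanonicalWord S → CanonicalWord (S ∷ʳ false)
extend-false {n} {S} (canonical ws arr pins xs ys refl lp free) =
  canonical (ws ++ [ n ]) (↭upTo-∷ʳ arr)
    (PinnacleSet-∷ʳ {S = S} pins (Pinnacle-∷ʳ⇔ ws) (mk⇔ (λ ()) (⊥-elim ∘ n∉ws ∘ Pinnacle-∷ʳ⇒∈ ws)))
    xs (ys ++ [ n ]) (++-assoc xs ys [ n ]) (trans lp (cong (2 *_) (sym (∣∷ʳfalse∣ S)))) free′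
  where
    n∉ws : n ∉ ws
    n∉ws n∈ws = <-irrefl refl (∈-↭upTo⁻ arr n∈ws)
    free′ : ∀ {x} → x ∈ ys ++ [ n ] → ¬ Pinnacle x (ws ++ [ n ])
    free′ x∈ p with ∈-++⁻ ys x∈
    ... | inj₁ x∈ys = free x∈ys (Equivalence.from (Pinnacle-∷ʳ⇔ ws (∈-↭upTo⁻ arr (∈-++⁺ʳ xs x∈ys))) p)
    ... | inj₂ (here refl) = n∉ws (Pinnacle-∷ʳ⇒∈ ws p)

2≤length-suffix : ∀ {n} (S : Subset n) (xs ys : List ℕ) → length xs ≡ 2 * ∣ S ∣ → length (xs ++ ys) ≡ n →
  2 * suc ∣ S ∣ ≤ n → 2 ≤ length ys
2≤length-suffix {n} S xs ys lp len bound = +-cancelˡ-≤ (2 * ∣ S ∣) 2 (length ys) (begin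
  2 * ∣ S ∣ + 2          ≡⟨ +-comm (2 * ∣ S ∣) 2 ⟩
  2 + 2 * ∣ S ∣          ≡⟨ *-suc 2 ∣ S ∣ ⟨
  2 * suc ∣ S ∣          ≤⟨ bound ⟩
  n                      ≡⟨ len ⟨
  length (xs ++ ys)      ≡⟨ length-++ xs ⟩
  length xs + length ys  ≡⟨ cong (_+ length ys) lp ⟩
  2 * ∣ S ∣ + length ys  ∎)
  where open ≤-Reasoning

extend-true : ∀ {n} {S : Subset n} → 2 * suc ∣ S ∣ ≤ n → CanonicalWord S → CanonicalWord (S ∷ʳ true)
extend-true {S = S} bound (canonical _ arr _ xs [] refl lp _)
  with () ← 2≤length-suffix S xs [] lp (length-↭upTo arr) bound
extend-true {S = S} bound (canonical _ arr _ xs (_ ∷ []) refl lp _)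
  with s≤s () ← 2≤length-suffix S xs (_ ∷ []) lp (length-↭upTo arr) bound
extend-true {n} {S} bound (canonical _ arr pins xs (b ∷ c ∷ ys) refl lp free) =
  canonical (xs ++ b ∷ n ∷ c ∷ ys) arr′ (PinnacleSet-∷ʳ {S = S} pins same top)
    (xs ++ b ∷ n ∷ []) (c ∷ ys) (sym (++-assoc xs (b ∷ n ∷ []) (c ∷ ys))) lp′ free′
  where
    below : ∀ {x} → x ∈ xs ++ b ∷ c ∷ ys → x < n
    below = ∈-↭upTo⁻ arr
    same : ∀ {v} → v < n → Pinnacle v (xs ++ b ∷ c ∷ ys) ⇔ Pinnacle v (xs ++ b ∷ n ∷ c ∷ ys)
    same v<n = Pinnacle-insert⇔ xs (c ∷ ys) v<n free
    top : (true ≡ true) ⇔ Pinnacle n (xs ++ b ∷ n ∷ c ∷ ys)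
    top = mk⇔ (λ _ → Pinnacle-inserted xs ys (below (∈-++⁺ʳ xs (here refl)))
                                             (below (∈-++⁺ʳ xs (there (here refl)))))
              (λ _ → refl)
    arr′ : xs ++ b ∷ n ∷ c ∷ ys ↭ upTo (suc n)
    arr′ = subst (_↭ upTo (suc n)) (++-assoc xs [ b ] (n ∷ c ∷ ys))
             (↭upTo-insert (xs ++ [ b ]) (c ∷ ys) (subst (_↭ upTo n) (sym (++-assoc xs [ b ] (c ∷ ys))) arr))
    lp′ : length (xs ++ b ∷ n ∷ []) ≡ 2 * ∣ S ∷ʳ true ∣
    lp′ = begin
      length (xs ++ b ∷ n ∷ []) ≡⟨ length-++ xs ⟩
      length xs + 2             ≡⟨ cong (_+ 2) lp ⟩
      2 * ∣ S ∣ + 2             ≡⟨ +-comm (2 * ∣ S ∣) 2 ⟩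
      2 + 2 * ∣ S ∣             ≡⟨ *-suc 2 ∣ S ∣ ⟨
      2 * suc ∣ S ∣             ≡⟨ cong (2 *_) (∣∷ʳtrue∣ S) ⟨
      2 * ∣ S ∷ʳ true ∣         ∎
      where open ≡-Reasoning
    free′ : ∀ {x} → x ∈ c ∷ ys → ¬ Pinnacle x (xs ++ b ∷ n ∷ c ∷ ys)
    free′ x∈ p = free (there x∈) (Equivalence.from (same (below (∈-++⁺ʳ xs (there x∈)))) p)

canonicalWord : ∀ {n} (S : Subset n) → Admissible 0 S → CanonicalWord S
canonicalWord []          _ = canonical [] ↭-refl (λ ()) [] [] refl refl (λ ())
canonicalWord {suc n} S a with initLast S
... | S′ , false , refl = extend-false (canonicalWord S′ (Admissible-∷ʳ⁻ a))
... | S′ , true  , refl = extend-true (Admissible-∷ʳtrue⁻ a) (canonicalWord S′ (Admissible-∷ʳ⁻ a))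

InAPS⇔Admissible : ∀ n (S : Subset n) → InAPS n S ⇔ Admissible 0 S
InAPS⇔Admissible n S = mk⇔ necessary sufficient
  where
    necessary : InAPS n S → Admissible 0 S
    necessary (w , pins) = ⊆Pinnacles⇒Admissible S (wordOf-↭upTo w) λ v e →
      Equivalence.to (IsPinnacle⇔Pinnacle w v) (Equivalence.to (pins v) (lookup⇒[]= v S e))
    sufficient : Admissible 0 S → InAPS n S
    sufficient a with canonical _ arr pins _ _ _ _ _ ← canonicalWord S a
                 with w , refl ← ↭upTo⇒wordOf arr =
      w , λ v → ⇔-trans (↔⇒⇔ []=↔lookup) (⇔-trans (pins v) (⇔-sym (IsPinnacle⇔Pinnacle w v)))

proposition3p11 : (n : ℕ) → 1 ≤ n → (d : ℕ) → d ≤ (n ∸ 1) / 2 →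
    HasCard n (SmallAPS n d) ((n ∸ 1) C d)
proposition3p11 (suc m) _ d d≤m/2 =
  admissibles (suc m) 0 d , admissibles-unique (suc m) 0 d , members , length-admissibles-0 m d 2d≤m
  where
    2d≤m : 2 * d ≤ m
    2d≤m = ≤-trans (*-monoʳ-≤ 2 d≤m/2) (subst (_≤ m) (*-comm (m / 2) 2) (m/n*n≤m m 2))
    members : (S : Subset (suc m)) → (S ∈ admissibles (suc m) 0 d) ⇔ SmallAPS (suc m) d S
    members S = mk⇔ (map₁ (Equivalence.from characterisation) ∘ ∈-admissibles⁻)
                    (uncurry (∈-admissibles⁺ ∘ Equivalence.to characterisation))
      where characterisation = InAPS⇔Admissible (suc m) S
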